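{- For every $n\ge 1$ and all $p,q\in\mathbb{Z}$ with $1\le |q|<q_n$, we have \[ |qp_n-pq_n|\ge \frac{q_n}{2C_1|q|}. \]
   Context: Fix a real number $\alpha\in(0,1/2)$ and a constant $C_1>1$ such that $|q\alpha-p|\ge 1/(C_1|q|)$ for all $p,q\in\mathbb{Z}$ with $q\neq0$ (i.e. $\alpha$ is badly approximable). Let $(p_n)_{n\ge1},(q_n)_{n\ge1}$ be the sequences of integers given by the continued fraction convergents of $\alpha$, indexed so that for each $n\ge1$: $0\le p_n\le q_n$, $p_1=0$, $q_1=1$; $q_np_{n+1}-p_nq_{n+1}=(-1)^{n+1}$; $|q_n\alpha-p_n|<q_{n+1}^{ -1}$; and $q_n<q_{n+1}\le C_1q_n$. -}

module Defs where

open import Level using (0ℓ)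
open import Data.Nat as ℕ using (ℕ; zero; suc)
open import Data.Integer as ℤ using (ℤ; +_; -[1+_])
open import Data.Sum using (_⊎_)
open import Relation.Binary.PropositionalEquality using (_≡_)
open import Relation.Binary.Structures using (IsStrictTotalOrder)
open import Relation.Binary.Definitions using (tri<; tri≈; tri>)
open import Relation.Nullary using (¬_)
open import Algebra.Structures using (IsCommutativeRing)

-- An ordered field (with propositional equality as the equality).
-- The real numbers ℝ are an instance; agda-stdlib has no reals, so the
-- statement is made for an arbitrary ordered field.
record OrderedField : Set₁ where
  infixl 6 _+_
  infixl 7 _*_
  infix  4 _<_ _≤_
  infixl 6 _-_
  infixl 7 _/_
  field
    Carrier : Set
    _+_ _*_ : Carrier → Carrier → Carrier
    -_      : Carrier → Carrier
    0# 1#   : Carrier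
    _⁻¹     : Carrier → Carrier          -- total; value at 0 irrelevant
    _<_     : Carrier → Carrier → Set
    isCommutativeRing : IsCommutativeRing _≡_ _+_ _*_ -_ 0# 1#
    ⁻¹-inverse : ∀ x → ¬ (x ≡ 0#) → x * (x ⁻¹) ≡ 1#
    isStrictTotalOrder : IsStrictTotalOrder _≡_ _<_
    0<1     : 0# < 1#
    +-mono-< : ∀ {x y} z → x < y → x + z < y + z
    *-pos    : ∀ {x y} → 0# < x → 0# < y → 0# < x * y

  _≤_ : Carrier → Carrier → Set
  x ≤ y = x < y ⊎ x ≡ y

  _-_ : Carrier → Carrier → Carrier
  x - y = x + (- y)

  _/_ : Carrier → Carrier → Carrier
  x / y = x * (y ⁻¹)

  abs : Carrier → Carrier
  abs x with IsStrictTotalOrder.compare isStrictTotalOrder x 0#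
  ... | tri< _ _ _ = - x
  ... | tri≈ _ _ _ = x
  ... | tri> _ _ _ = x

  fromℕ : ℕ → Carrier
  fromℕ zero    = 0#
  fromℕ (suc n) = 1# + fromℕ n

  fromℤ : ℤ → Carrier
  fromℤ (+ n)     = fromℕ n
  fromℤ -[1+ n ]  = - fromℕ (suc n)

{-# OPTIONS --safe #-}
module Submission where

-- The integer r = q pₙ − p qₙ cannot vanish: the determinant identity makes qₙ and pₙ coprime, so
-- q pₙ = p qₙ would force qₙ ∣ q, impossible for 1 ≤ |q| < qₙ; hence |r| ≥ 1.  Multiplying
-- q α − p by qₙ gives qₙ (q α − p) = r + q (qₙ α − pₙ), and the last term has absolute value below
-- |q| / qₙ₊₁ < 1 ≤ |r|.  So qₙ |q α − p| ≤ 2 |r|, and the badly-approximable bound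
-- |q α − p| ≥ 1 / (C₁ |q|) gives the claim.

open import Defs
open import Level using (0ℓ)
open import Data.Nat as ℕ using (ℕ; zero; suc)
import Data.Nat.Properties as ℕ
import Data.Nat.Divisibility as ℕ
open import Data.Integer as ℤ using (ℤ; +_; -[1+_]; ∣_∣)
import Data.Integer.Properties as ℤ
open import Data.Integer.Divisibility using (_∣_)
open import Data.Integer.Divisibility.Signed using (∣ᵤ⇒∣; ∣⇒∣ᵤ; ∣m⇒∣m*n; ∣n⇒∣m*n; ∣m∣n⇒∣m-n; ∣-refl)
open import Data.Integer.Coprimality using (Coprime; coprime-divisor)
open import Data.Sign as Sign using (Sign)
open import Data.Maybe using (Maybe; just; nothing)
open import Data.Product using (_×_; _,_; proj₁)
open import Data.Sum using (inj₁; inj₂; _⊎_)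
open import Data.Empty using (⊥-elim)
open import Relation.Nullary using (¬_; yes; no)
open import Relation.Binary.PropositionalEquality
open import Relation.Binary.Definitions using (tri<; tri≈; tri>)
open import Relation.Binary.Structures using (IsStrictTotalOrder)
open import Algebra.Bundles using (CommutativeRing)
open import Relation.Binary.Bundles using (StrictPartialOrder)
import Algebra.Properties.Ring as RingProperties
import Algebra.Properties.AbelianGroup as AbelianGroupProperties
import Algebra.Properties.CommutativeSemigroup as CommutativeSemigroupProperties
open import Algebra.Solver.Ring.AlmostCommutativeRing
  using (fromCommutativeRing; _-Raw-AlmostCommutative⟶_; Induced-equivalence)
import Algebra.Solver.Ring as RingSolver
import Relation.Binary.Reasoning.StrictPartialOrder as StrictReasoning

∣-1^n∣≡1 : ∀ n → ∣ (ℤ.- (+ 1)) ℤ.^ n ∣ ≡ 1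
∣-1^n∣≡1 zero    = refl
∣-1^n∣≡1 (suc n) = trans (ℤ.abs-* (ℤ.- (+ 1)) ((ℤ.- (+ 1)) ℤ.^ n)) (cong (ℕ._+ 0) (∣-1^n∣≡1 n))

unimodular⇒coprime : ∀ a b c d → ∣ a ℤ.* d ℤ.- b ℤ.* c ∣ ≡ 1 → Coprime a b
unimodular⇒coprime a b c d det {k} (k∣a , k∣b) = ℕ.∣1⇒≡1 (subst (k ℕ.∣_) det
  (∣⇒∣ᵤ {+ k} (∣m∣n⇒∣m-n (∣m⇒∣m*n d (∣ᵤ⇒∣ {+ k} {a} k∣a)) (∣m⇒∣m*n c (∣ᵤ⇒∣ {+ k} {b} k∣b)))))

coprime⇒cross-nonzero : ∀ Q P p q → Coprime Q P → 1 ℕ.≤ ∣ q ∣ → + ∣ q ∣ ℤ.< Q →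
  1 ℕ.≤ ∣ q ℤ.* P ℤ.- p ℤ.* Q ∣
coprime⇒cross-nonzero Q P p q Q⊥P 1≤∣q∣ (ℤ.+<+ ∣q∣<∣Q∣) =
  ℕ.n≢0⇒n>0 λ r≡0 → ℕ.<⇒≱ ∣q∣<∣Q∣ (ℕ.∣⇒≤ {{ℕ.>-nonZero 1≤∣q∣}} (Q∣q r≡0))
  where
  Q∣q : ∣ q ℤ.* P ℤ.- p ℤ.* Q ∣ ≡ 0 → Q ∣ q
  Q∣q r≡0 = coprime-divisor Q P q Q⊥P (subst (Q ∣_) pQ≡Pq (∣⇒∣ᵤ (∣n⇒∣m*n p ∣-refl)))
    where
    pQ≡Pq : p ℤ.* Q ≡ P ℤ.* q
    pQ≡Pq = trans (sym (ℤ.i-j≡0⇒i≡j _ _ (ℤ.∣i∣≡0⇒i≡0 r≡0))) (ℤ.*-comm q P)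

module OrderedFieldProperties (F : OrderedField) where
  open OrderedField F

  commutativeRing : CommutativeRing 0ℓ 0ℓ
  commutativeRing = record { isCommutativeRing = isCommutativeRing }

  open CommutativeRing commutativeRing
    using (+-assoc; +-comm; +-identityˡ; +-identityʳ; -‿inverseʳ; *-assoc; *-comm;
           *-identityˡ; *-identityʳ; zeroˡ; zeroʳ; distribʳ; +-abelianGroup; +-commutativeSemigroup;
           *-commutativeSemigroup)
  open RingProperties (CommutativeRing.ring commutativeRing) using (-1*x≈-x)
  open AbelianGroupProperties +-abelianGroup
    using () renaming (⁻¹-involutive to neg-involutive; ε⁻¹≈ε to neg-0#; ⁻¹-∙-comm to neg+neg)
  open CommutativeSemigroupProperties +-commutativeSemigroup using (interchange)
  open CommutativeSemigroupProperties *-commutativeSemigroup using () renaming (interchange to *-interchange)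

  fromℕ-+ : ∀ m n → fromℕ (m ℕ.+ n) ≡ fromℕ m + fromℕ n
  fromℕ-+ zero    n = sym (+-identityˡ (fromℕ n))
  fromℕ-+ (suc m) n = trans (cong (λ z → 1# + z) (fromℕ-+ m n)) (sym (+-assoc 1# (fromℕ m) (fromℕ n)))

  fromℕ-* : ∀ m n → fromℕ (m ℕ.* n) ≡ fromℕ m * fromℕ n
  fromℕ-* zero    n = sym (zeroˡ (fromℕ n))
  fromℕ-* (suc m) n = begin
    fromℕ (n ℕ.+ m ℕ.* n)          ≡⟨ fromℕ-+ n (m ℕ.* n) ⟩
    fromℕ n + fromℕ (m ℕ.* n)      ≡⟨ cong₂ _+_ (sym (*-identityˡ (fromℕ n))) (fromℕ-* m n) ⟩
    1# * fromℕ n + fromℕ m * fromℕ n ≡⟨ sym (distribʳ (fromℕ n) 1# (fromℕ m)) ⟩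
    (1# + fromℕ m) * fromℕ n       ∎
    where open ≡-Reasoning

  fromℤ-neg : ∀ i → fromℤ (ℤ.- i) ≡ - fromℤ i
  fromℤ-neg -[1+ n ]     = sym (neg-involutive (fromℕ (suc n)))
  fromℤ-neg (+ zero)     = sym neg-0#
  fromℤ-neg (+ (suc n))  = refl

  [x+a]-[x+b]≡a-b : ∀ x a b → (x + a) - (x + b) ≡ a - b
  [x+a]-[x+b]≡a-b x a b = begin
    (x + a) + - (x + b)     ≡⟨ cong (λ z → (x + a) + z) (sym (neg+neg x b)) ⟩
    (x + a) + (- x + - b)   ≡⟨ interchange x a (- x) (- b) ⟩
    (x - x) + (a - b)       ≡⟨ cong (_+ (a - b)) (-‿inverseʳ x) ⟩
    0# + (a - b)            ≡⟨ +-identityˡ (a - b) ⟩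
    a - b                   ∎
    where open ≡-Reasoning

  fromℤ-⊖ : ∀ m n → fromℤ (m ℤ.⊖ n) ≡ fromℕ m - fromℕ n
  fromℤ-⊖ m       zero    = sym (trans (cong (λ z → fromℕ m + z) neg-0#) (+-identityʳ (fromℕ m)))
  fromℤ-⊖ zero    (suc n) = sym (+-identityˡ (- fromℕ (suc n)))
  fromℤ-⊖ (suc m) (suc n) = begin
    fromℤ (suc m ℤ.⊖ suc n)  ≡⟨ cong fromℤ (ℤ.[1+m]⊖[1+n]≡m⊖n m n) ⟩
    fromℤ (m ℤ.⊖ n)          ≡⟨ fromℤ-⊖ m n ⟩
    fromℕ m - fromℕ n        ≡⟨ sym ([x+a]-[x+b]≡a-b 1# (fromℕ m) (fromℕ n)) ⟩
    fromℕ (suc m) - fromℕ (suc n) ∎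
    where open ≡-Reasoning

  fromℤ-+ : ∀ i j → fromℤ (i ℤ.+ j) ≡ fromℤ i + fromℤ j
  fromℤ-+ -[1+ m ] -[1+ n ] = begin
    - fromℕ (suc (suc (m ℕ.+ n)))       ≡⟨ cong (λ k → - fromℕ (suc k)) (sym (ℕ.+-suc m n)) ⟩
    - fromℕ (suc m ℕ.+ suc n)           ≡⟨ cong -_ (fromℕ-+ (suc m) (suc n)) ⟩
    - (fromℕ (suc m) + fromℕ (suc n))   ≡⟨ sym (neg+neg (fromℕ (suc m)) (fromℕ (suc n))) ⟩
    - fromℕ (suc m) + - fromℕ (suc n)   ∎
    where open ≡-Reasoning
  fromℤ-+ -[1+ m ] (+ n)    = trans (fromℤ-⊖ n (suc m)) (+-comm (fromℕ n) (- fromℕ (suc m)))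
  fromℤ-+ (+ m)    -[1+ n ] = fromℤ-⊖ m (suc n)
  fromℤ-+ (+ m)    (+ n)    = fromℕ-+ m n

  fromSign : Sign → Carrier
  fromSign Sign.+ = 1#
  fromSign Sign.- = - 1#

  fromSign-* : ∀ s t → fromSign (s Sign.* t) ≡ fromSign s * fromSign t
  fromSign-* Sign.+ t      = sym (*-identityˡ (fromSign t))
  fromSign-* Sign.- Sign.+ = sym (*-identityʳ (- 1#))
  fromSign-* Sign.- Sign.- = sym (trans (-1*x≈-x (- 1#)) (neg-involutive 1#))

  fromℤ-◃ : ∀ s n → fromℤ (s ℤ.◃ n) ≡ fromSign s * fromℕ n
  fromℤ-◃ s      zero    = sym (zeroʳ (fromSign s))
  fromℤ-◃ Sign.+ (suc n) = sym (*-identityˡ (fromℕ (suc n)))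
  fromℤ-◃ Sign.- (suc n) = sym (-1*x≈-x (fromℕ (suc n)))

  fromℤ-* : ∀ i j → fromℤ (i ℤ.* j) ≡ fromℤ i * fromℤ j
  fromℤ-* i j = begin
    fromℤ (i ℤ.* j)                                   ≡⟨ fromℤ-◃ (sᵢ Sign.* sⱼ) (∣ i ∣ ℕ.* ∣ j ∣) ⟩
    fromSign (sᵢ Sign.* sⱼ) * fromℕ (∣ i ∣ ℕ.* ∣ j ∣) ≡⟨ cong₂ _*_ (fromSign-* sᵢ sⱼ) (fromℕ-* ∣ i ∣ ∣ j ∣) ⟩
    (fromSign sᵢ * fromSign sⱼ) * (fromℕ ∣ i ∣ * fromℕ ∣ j ∣) ≡⟨ *-interchange _ _ _ _ ⟩
    (fromSign sᵢ * fromℕ ∣ i ∣) * (fromSign sⱼ * fromℕ ∣ j ∣) ≡⟨ sym (cong₂ _*_ (sign-abs i) (sign-abs j)) ⟩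
    fromℤ i * fromℤ j                                  ∎
    where
    open ≡-Reasoning
    sᵢ sⱼ : Sign
    sᵢ = ℤ.sign i
    sⱼ = ℤ.sign j
    sign-abs : ∀ k → fromℤ k ≡ fromSign (ℤ.sign k) * fromℕ ∣ k ∣
    sign-abs k = trans (cong fromℤ (sym (ℤ.◃-inverse k))) (fromℤ-◃ (ℤ.sign k) ∣ k ∣)

  fromℤ-homomorphism : ℤ.+-*-rawRing -Raw-AlmostCommutative⟶ fromCommutativeRing commutativeRing
  fromℤ-homomorphism = record
    { ⟦_⟧ = fromℤ ; +-homo = fromℤ-+ ; *-homo = fromℤ-* ; -‿homo = fromℤ-neg
    ; 0-homo = refl ; 1-homo = +-identityʳ 1# }

  coeff≟ : ∀ i j → Maybe (Induced-equivalence fromℤ-homomorphism i j)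
  coeff≟ i j with i ℤ.≟ j
  ... | yes refl = just refl
  ... | no  _    = nothing

  -- With ℤ rather than Carrier as coefficients the solver can decide cancellations such as x - x = 0.
  open RingSolver ℤ.+-*-rawRing (fromCommutativeRing commutativeRing) fromℤ-homomorphism coeff≟
    using (solve; _:=_; _:+_; _:*_; :-_; _:-_; con)

  open IsStrictTotalOrder isStrictTotalOrder
    using (compare; isStrictPartialOrder; asym) renaming (trans to <-trans; irrefl to <-irrefl)

  <-strictPartialOrder : StrictPartialOrder 0ℓ 0ℓ 0ℓ
  <-strictPartialOrder = record { isStrictPartialOrder = isStrictPartialOrder }

  module ≤-Reasoning = StrictReasoning <-strictPartialOrder

  <-≤-trans : ∀ {x y z} → x < y → y ≤ z → x < z
  <-≤-trans x<y (inj₁ y<z)  = <-trans x<y y<z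
  <-≤-trans x<y (inj₂ refl) = x<y

  ≤⇒≯ : ∀ {x y} → x ≤ y → ¬ (y < x)
  ≤⇒≯ (inj₁ x<y)  = asym x<y
  ≤⇒≯ (inj₂ refl) = <-irrefl refl

  +-monoˡ-≤ : ∀ {x y} z → x ≤ y → x + z ≤ y + z
  +-monoˡ-≤ z (inj₁ x<y)  = inj₁ (+-mono-< z x<y)
  +-monoˡ-≤ z (inj₂ refl) = inj₂ refl

  +-monoʳ-≤ : ∀ {x y} z → x ≤ y → z + x ≤ z + y
  +-monoʳ-≤ {x} {y} z x≤y = subst₂ _≤_ (+-comm x z) (+-comm y z) (+-monoˡ-≤ z x≤y)

  neg-antimono-< : ∀ {x y} → x < y → - y < - x
  neg-antimono-< {x} {y} x<y = subst₂ _<_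
    (solve 2 (λ x y → x :+ (:- x :- y) := :- y) refl x y)
    (solve 2 (λ x y → y :+ (:- x :- y) := :- x) refl x y)
    (+-mono-< (- x - y) x<y)

  *-monoʳ-< : ∀ {x y z} → 0# < z → x < y → z * x < z * y
  *-monoʳ-< {x} {y} {z} 0<z x<y = subst₂ _<_ (+-identityˡ (z * x))
    (solve 3 (λ x y z → z :* (y :- x) :+ z :* x := z :* y) refl x y z)
    (+-mono-< (z * x) (*-pos 0<z 0<y-x))
    where
    0<y-x : 0# < y - x
    0<y-x = subst (_< y - x) (-‿inverseʳ x) (+-mono-< (- x) x<y)

  *-monoʳ-≤ : ∀ {x y z} → 0# ≤ z → x ≤ y → z * x ≤ z * y
  *-monoʳ-≤ (inj₁ 0<z) (inj₁ x<y)  = inj₁ (*-monoʳ-< 0<z x<y)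
  *-monoʳ-≤ (inj₁ 0<z) (inj₂ refl) = inj₂ refl
  *-monoʳ-≤ {x} {y} (inj₂ refl) _  = inj₂ (trans (zeroˡ x) (sym (zeroˡ y)))

  *-monoˡ-≤ : ∀ {x y z} → 0# ≤ z → x ≤ y → x * z ≤ y * z
  *-monoˡ-≤ {x} {y} {z} 0≤z x≤y = subst₂ _≤_ (*-comm z x) (*-comm z y) (*-monoʳ-≤ 0≤z x≤y)

  *-nonneg : ∀ {x y} → 0# ≤ x → 0# ≤ y → 0# ≤ x * y
  *-nonneg {x} 0≤x 0≤y = subst (_≤ _) (zeroʳ x) (*-monoʳ-≤ 0≤x 0≤y)

  neg-antimono-≤ : ∀ {x y} → x ≤ y → - y ≤ - x
  neg-antimono-≤ (inj₁ x<y)  = inj₁ (neg-antimono-< x<y)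
  neg-antimono-≤ (inj₂ refl) = inj₂ refl

  neg-pos : ∀ {x} → x < 0# → 0# < - x
  neg-pos x<0 = subst (_< _) neg-0# (neg-antimono-< x<0)

  neg-neg : ∀ {x} → 0# < x → - x < 0#
  neg-neg 0<x = subst (_ <_) neg-0# (neg-antimono-< 0<x)

  0≤fromℕ : ∀ n → 0# ≤ fromℕ n
  0≤fromℕ zero    = inj₂ refl
  0≤fromℕ (suc n) = inj₁ (begin-strict
    0#             <⟨ 0<1 ⟩
    1#             ≡⟨ sym (+-identityʳ 1#) ⟩
    1# + 0#        ≤⟨ +-monoʳ-≤ 1# (0≤fromℕ n) ⟩
    1# + fromℕ n   ∎)
    where open ≤-Reasoning

  fromℕ-mono-≤ : ∀ {m n} → m ℕ.≤ n → fromℕ m ≤ fromℕ n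
  fromℕ-mono-≤ {n = n} ℕ.z≤n = 0≤fromℕ n
  fromℕ-mono-≤ (ℕ.s≤s m≤n)   = +-monoʳ-≤ 1# (fromℕ-mono-≤ m≤n)

  1≤fromℕ : ∀ {n} → 1 ℕ.≤ n → 1# ≤ fromℕ n
  1≤fromℕ {n} 1≤n = subst (_≤ fromℕ n) (+-identityʳ 1#) (fromℕ-mono-≤ 1≤n)

  0<fromℕ : ∀ {n} → 1 ℕ.≤ n → 0# < fromℕ n
  0<fromℕ 1≤n = <-≤-trans 0<1 (1≤fromℕ 1≤n)

  fromℤ-mono-≤ : ∀ {i j} → i ℤ.≤ j → fromℤ i ≤ fromℤ j
  fromℤ-mono-≤ (ℤ.-≤- {m} {n} n≤m) = neg-antimono-≤ (fromℕ-mono-≤ {suc n} {suc m} (ℕ.s≤s n≤m))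
  fromℤ-mono-≤ { -[1+ m ]} {+ n} ℤ.-≤+ = inj₁ (<-≤-trans (neg-neg (0<fromℕ {suc m} (ℕ.s≤s ℕ.z≤n))) (0≤fromℕ n))
  fromℤ-mono-≤ (ℤ.+≤+ m≤n)         = fromℕ-mono-≤ m≤n

  +-mono-≤ : ∀ {x x′ y y′} → x ≤ x′ → y ≤ y′ → x + y ≤ x′ + y′
  +-mono-≤ {x} {x′} {y} {y′} x≤x′ y≤y′ = begin
    x + y    ≤⟨ +-monoˡ-≤ y x≤x′ ⟩
    x′ + y   ≤⟨ +-monoʳ-≤ x′ y≤y′ ⟩
    x′ + y′  ∎
    where open ≤-Reasoning

  abs-unique : ∀ {x z} → 0# ≤ z → z ≡ x ⊎ z ≡ - x → abs x ≡ z
  abs-unique {x} 0≤z z≡±x with compare x 0# | z≡±x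
  ... | tri< x<0 _ _  | inj₁ refl = ⊥-elim (≤⇒≯ 0≤z x<0)
  ... | tri< _ _ _    | inj₂ z≡-x = sym z≡-x
  ... | tri≈ _ _ _    | inj₁ z≡x  = sym z≡x
  ... | tri≈ _ refl _ | inj₂ z≡-x = sym (trans z≡-x neg-0#)
  ... | tri> _ _ _    | inj₁ z≡x  = sym z≡x
  ... | tri> _ _ 0<x  | inj₂ refl = ⊥-elim (≤⇒≯ 0≤z (neg-neg 0<x))

  abs≡±x : ∀ x → abs x ≡ x ⊎ abs x ≡ - x
  abs≡±x x with compare x 0#
  ... | tri< _ _ _ = inj₂ refl
  ... | tri≈ _ _ _ = inj₁ refl
  ... | tri> _ _ _ = inj₁ refl

  0≤abs : ∀ x → 0# ≤ abs x
  0≤abs x with compare x 0#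
  ... | tri< x<0 _ _  = inj₁ (neg-pos x<0)
  ... | tri≈ _ refl _ = inj₂ refl
  ... | tri> _ _ 0<x  = inj₁ 0<x

  x≤abs : ∀ x → x ≤ abs x
  x≤abs x with compare x 0#
  ... | tri< x<0 _ _ = inj₁ (<-trans x<0 (neg-pos x<0))
  ... | tri≈ _ _ _   = inj₂ refl
  ... | tri> _ _ _   = inj₂ refl

  -x≤abs : ∀ x → - x ≤ abs x
  -x≤abs x with compare x 0#
  ... | tri< _ _ _    = inj₂ refl
  ... | tri≈ _ refl _ = inj₂ neg-0#
  ... | tri> _ _ 0<x  = inj₁ (<-trans (neg-neg 0<x) 0<x)

  abs-≤ : ∀ {x y} → x ≤ y → - x ≤ y → abs x ≤ y
  abs-≤ {x} x≤y -x≤y with compare x 0#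
  ... | tri< _ _ _ = -x≤y
  ... | tri≈ _ _ _ = x≤y
  ... | tri> _ _ _ = x≤y

  abs-nonneg : ∀ {x} → 0# ≤ x → abs x ≡ x
  abs-nonneg 0≤x = abs-unique 0≤x (inj₁ refl)

  abs-triangle : ∀ x y → abs (x + y) ≤ abs x + abs y
  abs-triangle x y = abs-≤ (+-mono-≤ (x≤abs x) (x≤abs y))
    (subst (_≤ abs x + abs y) (neg+neg x y) (+-mono-≤ (-x≤abs x) (-x≤abs y)))

  abs-* : ∀ x y → abs (x * y) ≡ abs x * abs y
  abs-* x y = abs-unique (*-nonneg (0≤abs x) (0≤abs y)) (signs (abs≡±x x) (abs≡±x y))
    where
    signs : abs x ≡ x ⊎ abs x ≡ - x → abs y ≡ y ⊎ abs y ≡ - y →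
            abs x * abs y ≡ x * y ⊎ abs x * abs y ≡ - (x * y)
    signs (inj₁ ∣x∣≡x)  (inj₁ ∣y∣≡y)  = inj₁ (cong₂ _*_ ∣x∣≡x ∣y∣≡y)
    signs (inj₁ ∣x∣≡x)  (inj₂ ∣y∣≡-y) = inj₂ (trans (cong₂ _*_ ∣x∣≡x ∣y∣≡-y)
      (solve 2 (λ x y → x :* (:- y) := :- (x :* y)) refl x y))
    signs (inj₂ ∣x∣≡-x) (inj₁ ∣y∣≡y)  = inj₂ (trans (cong₂ _*_ ∣x∣≡-x ∣y∣≡y)
      (solve 2 (λ x y → (:- x) :* y := :- (x :* y)) refl x y))
    signs (inj₂ ∣x∣≡-x) (inj₂ ∣y∣≡-y) = inj₁ (trans (cong₂ _*_ ∣x∣≡-x ∣y∣≡-y)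
      (solve 2 (λ x y → (:- x) :* (:- y) := x :* y) refl x y))

  abs-fromℤ : ∀ i → abs (fromℤ i) ≡ fromℕ ∣ i ∣
  abs-fromℤ (+ n)    = abs-nonneg (0≤fromℕ n)
  abs-fromℤ -[1+ n ] = abs-unique (0≤fromℕ (suc n)) (inj₂ (sym (neg-involutive (fromℕ (suc n)))))

  ⁻¹-inverse-pos : ∀ {x} → 0# < x → x * x ⁻¹ ≡ 1#
  ⁻¹-inverse-pos 0<x = ⁻¹-inverse _ λ x≡0 → <-irrefl (sym x≡0) 0<x

  ⁻¹-pos : ∀ {x} → 0# < x → 0# < x ⁻¹
  ⁻¹-pos {x} 0<x with compare (x ⁻¹) 0#
  ... | tri< x⁻¹<0 _ _ = ⊥-elim (asym 0<1 (subst₂ _<_ (⁻¹-inverse-pos 0<x) (zeroʳ x) (*-monoʳ-< 0<x x⁻¹<0)))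
  ... | tri≈ _ x⁻¹≡0 _ = ⊥-elim (<-irrefl (trans (sym (zeroʳ x)) (trans (cong (λ z → x * z) (sym x⁻¹≡0)) (⁻¹-inverse-pos 0<x))) 0<1)
  ... | tri> _ _ 0<x⁻¹ = 0<x⁻¹

  /-*-cancel : ∀ x {y} → 0# < y → x / y * y ≡ x
  /-*-cancel x {y} 0<y = begin
    x * y ⁻¹ * y     ≡⟨ *-assoc x (y ⁻¹) y ⟩
    x * (y ⁻¹ * y)   ≡⟨ cong (λ z → x * z) (trans (*-comm (y ⁻¹) y) (⁻¹-inverse-pos 0<y)) ⟩
    x * 1#           ≡⟨ *-identityʳ x ⟩
    x                ∎
    where open ≡-Reasoning

  *-/-cancel : ∀ x {y} → 0# < y → x * y / y ≡ x
  *-/-cancel x {y} 0<y = begin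
    x * y * y ⁻¹     ≡⟨ *-assoc x y (y ⁻¹) ⟩
    x * (y * y ⁻¹)   ≡⟨ cong (λ z → x * z) (⁻¹-inverse-pos 0<y) ⟩
    x * 1#           ≡⟨ *-identityʳ x ⟩
    x                ∎
    where open ≡-Reasoning

  /≤⇒≤* : ∀ {x y z} → 0# < y → x / y ≤ z → x ≤ z * y
  /≤⇒≤* {x} {y} {z} 0<y x/y≤z = subst (_≤ z * y) (/-*-cancel x 0<y) (*-monoˡ-≤ (inj₁ 0<y) x/y≤z)

  </⇒*< : ∀ {x y z} → 0# < y → z < x / y → z * y < x
  </⇒*< {x} {y} {z} 0<y z<x/y = subst₂ _<_ (*-comm y z) (trans (*-comm y (x / y)) (/-*-cancel x 0<y))
    (*-monoʳ-< 0<y z<x/y)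

  ≤*⇒/≤ : ∀ {x y z} → 0# < y → x ≤ z * y → x / y ≤ z
  ≤*⇒/≤ {x} {y} {z} 0<y x≤zy = subst (x / y ≤_) (*-/-cancel z 0<y) (*-monoˡ-≤ (inj₁ (⁻¹-pos 0<y)) x≤zy)

  fromℤ-cross : ∀ a b c d → fromℤ (a ℤ.* b ℤ.- c ℤ.* d) ≡ fromℤ a * fromℤ b - fromℤ c * fromℤ d
  fromℤ-cross a b c d = begin
    fromℤ (a ℤ.* b ℤ.- c ℤ.* d)               ≡⟨ fromℤ-+ (a ℤ.* b) (ℤ.- (c ℤ.* d)) ⟩
    fromℤ (a ℤ.* b) + fromℤ (ℤ.- (c ℤ.* d))   ≡⟨ cong₂ _+_ (fromℤ-* a b) (fromℤ-neg (c ℤ.* d)) ⟩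
    fromℤ a * fromℤ b - fromℤ (c ℤ.* d)       ≡⟨ cong (λ z → fromℤ a * fromℤ b - z) (fromℤ-* c d) ⟩
    fromℤ a * fromℤ b - fromℤ c * fromℤ d     ∎
    where open ≡-Reasoning

  cross-identity : ∀ α p q P Q →
    fromℤ Q * (fromℤ q * α - fromℤ p) ≡ fromℤ (q ℤ.* P ℤ.- p ℤ.* Q) + fromℤ q * (fromℤ Q * α - fromℤ P)
  cross-identity α p q P Q = trans
    (solve 5 (λ α p q P Q → Q :* (q :* α :- p) := (q :* P :- p :* Q) :+ q :* (Q :* α :- P))
           refl α (fromℤ p) (fromℤ q) (fromℤ P) (fromℤ Q))
    (cong (_+ fromℤ q * (fromℤ Q * α - fromℤ P)) (sym (fromℤ-cross q P p Q)))

  Q∣qα-p∣≤2∣qP-pQ∣ : ∀ α p q P Q Q′ → + 0 ℤ.≤ Q → 1 ℕ.≤ ∣ q ∣ → + ∣ q ∣ ℤ.≤ Q′ →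
    1 ℕ.≤ ∣ q ℤ.* P ℤ.- p ℤ.* Q ∣ → abs (fromℤ Q * α - fromℤ P) < 1# / fromℤ Q′ →
    fromℤ Q * abs (fromℤ q * α - fromℤ p) ≤ (fromℕ ∣ q ℤ.* P ℤ.- p ℤ.* Q ∣) + (fromℕ ∣ q ℤ.* P ℤ.- p ℤ.* Q ∣)
  Q∣qα-p∣≤2∣qP-pQ∣ α p q P Q Q′ 0≤Q 1≤∣q∣ ∣q∣≤Q′ 1≤∣r∣ close = begin
    fromℤ Q * abs (fromℤ q * α - fromℤ p)             ≡⟨ cong (_* _) (sym (abs-nonneg (fromℤ-mono-≤ 0≤Q))) ⟩
    abs (fromℤ Q) * abs (fromℤ q * α - fromℤ p)       ≡⟨ sym (abs-* (fromℤ Q) _) ⟩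
    abs (fromℤ Q * (fromℤ q * α - fromℤ p))           ≡⟨ cong abs (cross-identity α p q P Q) ⟩
    abs (fromℤ r + fromℤ q * (fromℤ Q * α - fromℤ P)) ≤⟨ abs-triangle (fromℤ r) _ ⟩
    abs (fromℤ r) + abs (fromℤ q * (fromℤ Q * α - fromℤ P))
      ≡⟨ cong₂ _+_ (abs-fromℤ r) (trans (abs-* (fromℤ q) _) (cong (_* b) (abs-fromℤ q))) ⟩
    s + K * b                                         ≤⟨ +-monoʳ-≤ s (inj₁ (<-≤-trans Kb<1 (1≤fromℕ 1≤∣r∣))) ⟩
    s + s                                             ∎
    where
    open ≤-Reasoning
    r : ℤ
    r = q ℤ.* P ℤ.- p ℤ.* Q
    s K b : Carrier
    s = fromℕ ∣ r ∣
    K = fromℕ ∣ q ∣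
    b = abs (fromℤ Q * α - fromℤ P)
    K≤Q′ : K ≤ fromℤ Q′
    K≤Q′ = fromℤ-mono-≤ ∣q∣≤Q′
    Kb<1 : K * b < 1#
    Kb<1 = begin-strict
      K * b          ≡⟨ *-comm K b ⟩
      b * K          ≤⟨ *-monoʳ-≤ (0≤abs _) K≤Q′ ⟩
      b * fromℤ Q′   <⟨ </⇒*< (<-≤-trans (0<fromℕ 1≤∣q∣) K≤Q′) close ⟩
      1#             ∎

  convergent-lower-bound : ∀ {α C} p q P Q Q′ → 0# < C →
    1 ℕ.≤ ∣ q ∣ → + ∣ q ∣ ℤ.< Q → Q ℤ.< Q′ → 1 ℕ.≤ ∣ q ℤ.* P ℤ.- p ℤ.* Q ∣ →
    1# / (C * fromℕ ∣ q ∣) ≤ abs (fromℤ q * α - fromℤ p) →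
    abs (fromℤ Q * α - fromℤ P) < 1# / fromℤ Q′ →
    fromℤ Q / (fromℕ 2 * C * fromℕ ∣ q ∣) ≤ fromℕ ∣ q ℤ.* P ℤ.- p ℤ.* Q ∣
  convergent-lower-bound {α} {C} p q P Q Q′ 0<C 1≤∣q∣ ∣q∣<Q Q<Q′ 1≤∣r∣ badly close =
    ≤*⇒/≤ (*-pos (*-pos (0<fromℕ {2} (ℕ.s≤s ℕ.z≤n)) 0<C) 0<K) (begin
      fromℤ Q                  ≡⟨ sym (*-identityʳ (fromℤ Q)) ⟩
      fromℤ Q * 1#             ≤⟨ *-monoʳ-≤ (inj₁ 0<Q) (/≤⇒≤* 0<CK badly) ⟩
      fromℤ Q * (a * (C * K))  ≡⟨ sym (*-assoc (fromℤ Q) a (C * K)) ⟩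
      fromℤ Q * a * (C * K)    ≤⟨ *-monoˡ-≤ (inj₁ 0<CK) Qa≤2s ⟩
      (s + s) * (C * K)        ≡⟨ solve 3 (λ s C K → (s :+ s) :* (C :* K) := s :* (con (+ 2) :* C :* K)) refl s C K ⟩
      s * (fromℕ 2 * C * K)    ∎)
    where
    open ≤-Reasoning
    s K a : Carrier
    s = fromℕ ∣ q ℤ.* P ℤ.- p ℤ.* Q ∣
    K = fromℕ ∣ q ∣
    a = abs (fromℤ q * α - fromℤ p)
    0<K : 0# < K
    0<K = 0<fromℕ 1≤∣q∣
    0<CK : 0# < C * K
    0<CK = *-pos 0<C 0<K
    ∣q∣≤Q : + ∣ q ∣ ℤ.≤ Q
    ∣q∣≤Q = ℤ.<⇒≤ ∣q∣<Q
    0<Q : 0# < fromℤ Q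
    0<Q = <-≤-trans 0<K (fromℤ-mono-≤ ∣q∣≤Q)
    Qa≤2s : fromℤ Q * a ≤ s + s
    Qa≤2s = Q∣qα-p∣≤2∣qP-pQ∣ α p q P Q Q′ (ℤ.≤-trans (ℤ.+≤+ ℕ.z≤n) ∣q∣≤Q) 1≤∣q∣
      (ℤ.≤-trans ∣q∣≤Q (ℤ.<⇒≤ Q<Q′)) 1≤∣r∣ close

lemma3p1 : (F : OrderedField) → let open OrderedField F in
    (α C₁ : Carrier) → 0# < α → α < 1# / fromℕ 2 → 1# < C₁ →
    (∀ (p q : ℤ) → q ≢ + 0 → 1# / (C₁ * fromℕ ∣ q ∣) ≤ abs (fromℤ q * α - fromℤ p)) →
    (pₛ qₛ : ℕ → ℤ) →
    (∀ n → 1 ℕ.≤ n → (+ 0 ℤ.≤ pₛ n) × (pₛ n ℤ.≤ qₛ n)) →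
    pₛ 1 ≡ + 0 → qₛ 1 ≡ + 1 →
    (∀ n → 1 ℕ.≤ n → qₛ n ℤ.* pₛ (suc n) ℤ.- pₛ n ℤ.* qₛ (suc n) ≡ (ℤ.- (+ 1)) ℤ.^ (suc n)) →
    (∀ n → 1 ℕ.≤ n → abs (fromℤ (qₛ n) * α - fromℤ (pₛ n)) < 1# / fromℤ (qₛ (suc n))) →
    (∀ n → 1 ℕ.≤ n → (qₛ n ℤ.< qₛ (suc n)) × (fromℤ (qₛ (suc n)) ≤ C₁ * fromℤ (qₛ n))) →
    ∀ (n : ℕ) → 1 ℕ.≤ n → ∀ (p q : ℤ) → 1 ℕ.≤ ∣ q ∣ → + ∣ q ∣ ℤ.< qₛ n →
    fromℤ (qₛ n) / (fromℕ 2 * C₁ * fromℕ ∣ q ∣) ≤ fromℕ ∣ q ℤ.* pₛ n ℤ.- p ℤ.* qₛ n ∣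
lemma3p1 F α C₁ _ _ 1<C₁ badly pₛ qₛ _ _ _ det close growth n 1≤n p q 1≤∣q∣ ∣q∣<qₙ =
  convergent-lower-bound p q (pₛ n) (qₛ n) (qₛ (suc n)) (<-trans 0<1 1<C₁)
    1≤∣q∣ ∣q∣<qₙ (proj₁ (growth n 1≤n)) (coprime⇒cross-nonzero (qₛ n) (pₛ n) p q qₙ⊥pₙ 1≤∣q∣ ∣q∣<qₙ)
    (badly p q q≢0) (close n 1≤n)
  where
  open OrderedField F using (0<1; isStrictTotalOrder)
  open IsStrictTotalOrder isStrictTotalOrder using () renaming (trans to <-trans)
  open OrderedFieldProperties F
  qₙ⊥pₙ : Coprime (qₛ n) (pₛ n)
  qₙ⊥pₙ = unimodular⇒coprime (qₛ n) (pₛ n) (qₛ (suc n)) (pₛ (suc n))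
    (trans (cong ∣_∣ (det n 1≤n)) (∣-1^n∣≡1 (suc n)))
  q≢0 : q ≢ + 0
  q≢0 q≡0 = ℕ.<⇒≢ 1≤∣q∣ (sym (cong ∣_∣ q≡0))
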